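{- Let $n,d$ be positive integers and run $\mathrm{UNFAIR}(m,n,d)$ with $m\ge n^{3d+12}$. With probability $1-O(n^{ -d-1})$, by the time $n^{3d+12}$ balls have been placed, every pair of distinct bins $B_i,B_j$ has achieved a load gap of at least $n^2$, i.e. for every pair $i\neq j$ there is some time $s\le n^{3d+12}$ at which the loads of $B_i$ and $B_j$ differ by at least $n^2$.
   Context: The process $\mathrm{UNFAIR}(m,n,d)$ places $m$ balls, one at a time, into $n$ initially empty bins $B_1,\dots,B_n$. At each time step an option tuple $(i_1,\dots,i_d)$ is chosen uniformly at random from $\{1,\dots,n\}^d$ (i.e. $d$ bins chosen independently with replacement), and the ball is placed in the currently \emph{most}-loaded of the chosen bins; ties are broken uniformly at random among the most-loaded chosen bins. Asymptotic notation refers to $n\to\infty$ with $d$ fixed. -}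

module Defs where

open import Data.Nat as ℕ using (ℕ; zero; suc; _≤ᵇ_; _∸_)
open import Data.Bool using (Bool; true; false; _∨_; _∧_; if_then_else_; not)
open import Data.Fin using (Fin; _≟_)
open import Data.List as List using (List; []; _∷_; map; filter; foldr; allFin; length; concatMap)
open import Data.Vec as Vec using (Vec)
open import Data.Integer using (+_)
open import Data.Rational using (ℚ; _/_; _+_; _*_; 0ℚ; 1ℚ)
import Data.Bool.ListAction
open import Relation.Nullary.Decidable using (⌊_⌋)
import Data.Vec.Membership.DecPropositional as VM

Loads : ℕ → Set
Loads n = Fin n → ℕ

-- Record of which ordered pairs (i , j) have already achieved a load gap ≥ n².
Gaps : ℕ → Set
Gaps n = Fin n → Fin n → Bool

dist : ℕ → ℕ → ℕ
dist a b = (a ∸ b) ℕ.+ (b ∸ a)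

allTuples : (n d : ℕ) → List (Vec (Fin n) d)
allTuples n zero = Vec.[] ∷ []
allTuples n (suc d) = concatMap (λ i → map (i Vec.∷_) (allTuples n d)) (allFin n)

-- Uniform average of a ℚ-valued function over a (nonempty) list; 0 on [].
avg : {A : Set} → List A → (A → ℚ) → ℚ
avg [] f = 0ℚ
avg (x ∷ xs) f = foldr (λ y acc → f y + acc) 0ℚ (x ∷ xs) * ((+ 1) / suc (length xs))

maxLoad : {n d : ℕ} → Loads n → Vec (Fin n) d → ℕ
maxLoad L v = Vec.foldr _ (λ i acc → L i ℕ.⊔ acc) 0 v

winners : {n d : ℕ} → Loads n → Vec (Fin n) d → List (Fin n)
winners {n} L v =
  List.filterᵇ (λ i → ⌊ VM._∈?_ (_≟_ {n}) i v ⌋ ∧ (maxLoad L v ≤ᵇ L i)) (allFin n)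

place : {n : ℕ} → Loads n → Fin n → Loads n
place L c i = if ⌊ i ≟ c ⌋ then suc (L i) else L i

-- Update the gap record at time t (number of balls placed so far),
-- only counting times t ≤ T.
update : (n T t : ℕ) → Loads n → Gaps n → Gaps n
update n T t L G i j = G i j ∨ ((t ≤ᵇ T) ∧ ((n ℕ.* n) ≤ᵇ dist (L i) (L j)))

allPairsDone : (n : ℕ) → Gaps n → Bool
allPairsDone n G =
  Data.Bool.ListAction.and (concatMap (λ i → map (λ j → ⌊ i ≟ j ⌋ ∨ G i j) (allFin n)) (allFin n))

-- failProb n d T k t L G : probability, running UNFAIR for k more balls
-- starting at time t with loads L and gap record G, that at the end some
-- pair of distinct bins has NOT achieved a gap ≥ n² at any time s ≤ T.
failProb : (n d T : ℕ) → (k t : ℕ) → Loads n → Gaps n → ℚ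
failProb n d T zero t L G =
  if allPairsDone n (update n T t L G) then 0ℚ else 1ℚ
failProb n d T (suc k) t L G =
  avg (allTuples n d) (λ v →
    avg (winners L v) (λ c →
      failProb n d T k (suc t) (place L c) (update n T t L G)))

unfairFail : (m n d T : ℕ) → ℚ
unfairFail m n d T = failProb n d T m 0 (λ _ → 0) (λ _ _ → false)

module Submission where

-- Fix bins i ≢ j with signed load difference g, and let D be the number of choices. The next
-- ball lands in i with probability pᵢ ≥ n⁻ᴰ (draw the tuple (i, …, i)), and pᵢ ≥ pⱼ when bin
-- i is the fuller one: swapping i and j inside the option tuple turns every draw won by j
-- into one won by i alone. Hence E[g′²] − g² = pᵢ + pⱼ + 2g(pᵢ − pⱼ) ≥ n⁻ᴰ, so
-- t + nᴰ (n⁴ − g²) cannot increase in expectation while |g| < n². Frozen at 0 once the pair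
-- has reached the gap n² and at T + 1 after the horizon T, it dominates T + 1 times the
-- indicator that the pair never reaches the gap. Summing over pairs, T + 1 times the failure
-- probability is at most n² · nᴰ · n⁴, which is below (T + 1) n⁻ᴰ⁻¹ for T = n^(3D+12).

open import Data.Nat using (ℕ)

module RationalOrder where
  open import Data.Rational
  open import Data.Rational.Properties
  open import Data.Rational.Solver
  open import Relation.Binary.PropositionalEquality
  open +-*-Solver

  p≤p+q : ∀ {p q} → 0ℚ ≤ q → p ≤ p + q
  p≤p+q {p} 0≤q = subst (_≤ p + _) (+-identityʳ p) (+-monoʳ-≤ p 0≤q)

  p≤q⇒0≤q-p : ∀ {p q} → p ≤ q → 0ℚ ≤ q - p
  p≤q⇒0≤q-p {p} {q} p≤q = subst (_≤ q - p) (+-inverseʳ p) (+-monoˡ-≤ (- p) p≤q)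

  0≤q-p⇒p≤q : ∀ {p q} → 0ℚ ≤ q - p → p ≤ q
  0≤q-p⇒p≤q {p} {q} 0≤q-p =
    subst (p ≤_) (solve 2 (λ p q → p :+ (q :- p) := q) refl p q) (p≤p+q 0≤q-p)

  +-nonNeg : ∀ {p q} → 0ℚ ≤ p → 0ℚ ≤ q → 0ℚ ≤ p + q
  +-nonNeg = +-mono-≤

  *-nonNeg : ∀ {p q} → 0ℚ ≤ p → 0ℚ ≤ q → 0ℚ ≤ p * q
  *-nonNeg {p} {q} 0≤p 0≤q =
    nonNegative⁻¹ (p * q) {{nonNeg*nonNeg⇒nonNeg p {{nonNegative 0≤p}} q {{nonNegative 0≤q}}}}

module FromNat where
  open import Data.Nat as ℕ using (ℕ; zero; suc)
  import Data.Nat.Properties as ℕ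
  import Data.Integer as ℤ
  open import Data.Integer.Tactic.RingSolver using (solve-∀)
  open import Data.Rational
  open import Data.Rational.Properties
  import Data.Rational.Unnormalised as ℚᵘ
  import Data.Rational.Unnormalised.Properties as ℚᵘ
  open import Data.Rational.Solver
  open import Relation.Binary.PropositionalEquality
  open +-*-Solver
  open RationalOrder

  -- Opaque, so that unification never unfolds the gcd normalisation hidden in ℤ.+ a / 1.
  opaque
    fromℕ : ℕ → ℚ
    fromℕ a = ℤ.+ a / 1

    fromℕ≡+/1 : ∀ a → fromℕ a ≡ ℤ.+ a / 1
    fromℕ≡+/1 a = refl

    toℚᵘ-fromℕ : ∀ a → toℚᵘ (fromℕ a) ℚᵘ.≃ ℚᵘ.mkℚᵘ (ℤ.+ a) 0
    toℚᵘ-fromℕ a = toℚᵘ-fromℚᵘ (ℚᵘ.mkℚᵘ (ℤ.+ a) 0)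

    fromℕ-0 : fromℕ 0 ≡ 0ℚ
    fromℕ-0 = refl

    fromℕ-1 : fromℕ 1 ≡ 1ℚ
    fromℕ-1 = refl

    fromℕ-nonNeg : ∀ a → 0ℚ ≤ fromℕ a
    fromℕ-nonNeg a = nonNegative⁻¹ (fromℕ a) {{normalize-nonNeg a 1}}

    fromℕ-inverse : ∀ l → fromℕ (suc l) * (ℤ.+ 1 / suc l) ≡ 1ℚ
    fromℕ-inverse l = toℚᵘ-injective (ℚᵘ.≃-trans (toℚᵘ-homo-* (fromℕ (suc l)) (ℤ.+ 1 / suc l))
      (ℚᵘ.≃-trans (ℚᵘ.*-cong (toℚᵘ-fromℕ (suc l)) (toℚᵘ-fromℚᵘ (ℚᵘ.mkℚᵘ (ℤ.+ 1) l)))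
                  (ℚᵘ.*≡* (cross (ℤ.+ suc l)))))
      where
      cross : ∀ x → (x ℤ.* ℤ.1ℤ) ℤ.* ℤ.1ℤ ≡ ℤ.1ℤ ℤ.* (ℤ.1ℤ ℤ.* x)
      cross = solve-∀

  fromℕ-suc : ∀ a → fromℕ (suc a) ≡ 1ℚ + fromℕ a
  fromℕ-suc a = toℚᵘ-injective (ℚᵘ.≃-trans (toℚᵘ-fromℕ (suc a)) (ℚᵘ.≃-trans numerators
    (ℚᵘ.≃-sym (ℚᵘ.≃-trans (toℚᵘ-homo-+ 1ℚ (fromℕ a)) (ℚᵘ.+-congʳ (toℚᵘ 1ℚ) (toℚᵘ-fromℕ a))))))
    where
    cross : ∀ x → (ℤ.1ℤ ℤ.+ x) ℤ.* ℤ.1ℤ ≡ (ℤ.1ℤ ℤ.+ x ℤ.* ℤ.1ℤ) ℤ.* ℤ.1ℤ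
    cross = solve-∀
    numerators : ℚᵘ.mkℚᵘ (ℤ.+ suc a) 0 ℚᵘ.≃ ℚᵘ.mkℚᵘ (ℤ.+ 1) 0 ℚᵘ.+ ℚᵘ.mkℚᵘ (ℤ.+ a) 0
    numerators = ℚᵘ.*≡* (cross (ℤ.+ a))

  fromℕ-+ : ∀ a b → fromℕ (a ℕ.+ b) ≡ fromℕ a + fromℕ b
  fromℕ-+ zero    b = sym (trans (cong (_+ fromℕ b) fromℕ-0) (+-identityˡ (fromℕ b)))
  fromℕ-+ (suc a) b = begin
    fromℕ (suc (a ℕ.+ b))     ≡⟨ fromℕ-suc (a ℕ.+ b) ⟩
    1ℚ + fromℕ (a ℕ.+ b)      ≡⟨ cong (1ℚ +_) (fromℕ-+ a b) ⟩
    1ℚ + (fromℕ a + fromℕ b)  ≡⟨ +-assoc 1ℚ (fromℕ a) (fromℕ b) ⟨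
    (1ℚ + fromℕ a) + fromℕ b  ≡⟨ cong (_+ fromℕ b) (fromℕ-suc a) ⟨
    fromℕ (suc a) + fromℕ b   ∎
    where open ≡-Reasoning

  fromℕ-* : ∀ a b → fromℕ (a ℕ.* b) ≡ fromℕ a * fromℕ b
  fromℕ-* zero    b = trans fromℕ-0 (sym (trans (cong (_* fromℕ b) fromℕ-0) (*-zeroˡ (fromℕ b))))
  fromℕ-* (suc a) b = begin
    fromℕ (b ℕ.+ a ℕ.* b)        ≡⟨ fromℕ-+ b (a ℕ.* b) ⟩
    fromℕ b + fromℕ (a ℕ.* b)    ≡⟨ cong (fromℕ b +_) (fromℕ-* a b) ⟩
    fromℕ b + fromℕ a * fromℕ b  ≡⟨ solve 2 (λ x y → y :+ x :* y := (con 1ℚ :+ x) :* y) refl (fromℕ a) (fromℕ b) ⟩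
    (1ℚ + fromℕ a) * fromℕ b     ≡⟨ cong (_* fromℕ b) (fromℕ-suc a) ⟨
    fromℕ (suc a) * fromℕ b      ∎
    where open ≡-Reasoning

  fromℕ-mono-≤ : ∀ {a b} → a ℕ.≤ b → fromℕ a ≤ fromℕ b
  fromℕ-mono-≤ {a} {b} a≤b = begin
    fromℕ a                    ≤⟨ p≤p+q (fromℕ-nonNeg (b ℕ.∸ a)) ⟩
    fromℕ a + fromℕ (b ℕ.∸ a)  ≡⟨ fromℕ-+ a (b ℕ.∸ a) ⟨
    fromℕ (a ℕ.+ (b ℕ.∸ a))    ≡⟨ cong fromℕ (ℕ.m+[n∸m]≡n a≤b) ⟩
    fromℕ b                    ∎
    where open ≤-Reasoning

  fromℕ-∸ : ∀ {a b} → b ℕ.≤ a → fromℕ (a ℕ.∸ b) ≡ fromℕ a - fromℕ b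
  fromℕ-∸ {a} {b} b≤a = begin
    fromℕ (a ℕ.∸ b)                        ≡⟨ solve 2 (λ x y → x := (y :+ x) :- y) refl (fromℕ (a ℕ.∸ b)) (fromℕ b) ⟩
    (fromℕ b + fromℕ (a ℕ.∸ b)) - fromℕ b  ≡⟨ cong (_- fromℕ b) (fromℕ-+ b (a ℕ.∸ b)) ⟨
    fromℕ (b ℕ.+ (a ℕ.∸ b)) - fromℕ b      ≡⟨ cong (λ c → fromℕ c - fromℕ b) (ℕ.m+[n∸m]≡n b≤a) ⟩
    fromℕ a - fromℕ b                      ∎
    where open ≡-Reasoning

module Averages where
  open import Data.Nat using (suc)
  import Data.Integer as ℤ
  open import Data.Rational
  open import Data.Rational.Properties
  open import Data.Rational.Solver
  open import Data.List using (List; []; _∷_; foldr; length; map; concatMap; _++_)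
  open import Data.List.Membership.Propositional using (_∈_)
  open import Data.List.Relation.Unary.Any using (Any; here; there)
  open import Relation.Binary.PropositionalEquality
  open import Defs using (avg)
  open +-*-Solver
  open RationalOrder
  open FromNat

  module _ {A : Set} where

    ∑ : List A → (A → ℚ) → ℚ
    ∑ xs f = foldr (λ y acc → f y + acc) 0ℚ xs

    ∑-cong : ∀ xs {f g} → (∀ x → x ∈ xs → f x ≡ g x) → ∑ xs f ≡ ∑ xs g
    ∑-cong []       f≡g = refl
    ∑-cong (x ∷ xs) f≡g = cong₂ _+_ (f≡g x (here refl)) (∑-cong xs (λ y y∈xs → f≡g y (there y∈xs)))

    ∑-mono : ∀ xs {f g} → (∀ x → f x ≤ g x) → ∑ xs f ≤ ∑ xs g
    ∑-mono []       f≤g = ≤-refl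
    ∑-mono (x ∷ xs) f≤g = +-mono-≤ (f≤g x) (∑-mono xs f≤g)

    ∑-nonNeg : ∀ xs {f} → (∀ x → 0ℚ ≤ f x) → 0ℚ ≤ ∑ xs f
    ∑-nonNeg []       0≤f = ≤-refl
    ∑-nonNeg (x ∷ xs) 0≤f = +-nonNeg (0≤f x) (∑-nonNeg xs 0≤f)

    ∑-+ : ∀ xs f g → ∑ xs (λ x → f x + g x) ≡ ∑ xs f + ∑ xs g
    ∑-+ []       f g = sym (+-identityˡ 0ℚ)
    ∑-+ (x ∷ xs) f g = trans (cong (f x + g x +_) (∑-+ xs f g))
      (solve 4 (λ a b c d → (a :+ b) :+ (c :+ d) := (a :+ c) :+ (b :+ d)) refl (f x) (g x) (∑ xs f) (∑ xs g))

    ∑-*ˡ : ∀ xs a f → ∑ xs (λ x → a * f x) ≡ a * ∑ xs f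
    ∑-*ˡ []       a f = sym (*-zeroʳ a)
    ∑-*ˡ (x ∷ xs) a f = trans (cong (a * f x +_) (∑-*ˡ xs a f)) (sym (*-distribˡ-+ a (f x) (∑ xs f)))

    ∑-const : ∀ xs a → ∑ xs (λ _ → a) ≡ fromℕ (length xs) * a
    ∑-const []       a = sym (trans (cong (_* a) fromℕ-0) (*-zeroˡ a))
    ∑-const (x ∷ xs) a = begin
      a + ∑ xs (λ _ → a)            ≡⟨ cong (a +_) (∑-const xs a) ⟩
      a + fromℕ (length xs) * a     ≡⟨ solve 2 (λ a l → a :+ l :* a := (con 1ℚ :+ l) :* a) refl a (fromℕ (length xs)) ⟩
      (1ℚ + fromℕ (length xs)) * a  ≡⟨ cong (_* a) (fromℕ-suc (length xs)) ⟨
      fromℕ (suc (length xs)) * a   ∎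
      where open ≡-Reasoning

    ∑-++ : ∀ xs ys f → ∑ (xs ++ ys) f ≡ ∑ xs f + ∑ ys f
    ∑-++ []       ys f = sym (+-identityˡ (∑ ys f))
    ∑-++ (x ∷ xs) ys f = trans (cong (f x +_) (∑-++ xs ys f)) (sym (+-assoc (f x) (∑ xs f) (∑ ys f)))

    ∑-≥-Any : ∀ {xs f a} → (∀ x → 0ℚ ≤ f x) → Any (λ x → a ≤ f x) xs → a ≤ ∑ xs f
    ∑-≥-Any {x ∷ xs}     0≤f (here a≤fx) = ≤-trans a≤fx (p≤p+q (∑-nonNeg xs 0≤f))
    ∑-≥-Any {x ∷ xs} {f} 0≤f (there a≤∑) = ≤-trans (∑-≥-Any 0≤f a≤∑)
      (subst (_≤ f x + ∑ xs f) (+-identityˡ (∑ xs f)) (+-monoˡ-≤ (∑ xs f) (0≤f x)))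

    weight : List A → ℚ
    weight []       = 0ℚ
    weight (x ∷ xs) = ℤ.+ 1 / suc (length xs)

    avg≡∑*weight : ∀ xs f → avg xs f ≡ ∑ xs f * weight xs
    avg≡∑*weight []       f = refl
    avg≡∑*weight (x ∷ xs) f = refl

    weight-nonNeg : ∀ xs → 0ℚ ≤ weight xs
    weight-nonNeg []       = ≤-refl
    weight-nonNeg (x ∷ xs) = nonNegative⁻¹ (weight (x ∷ xs)) {{normalize-nonNeg 1 (suc (length xs))}}

    avg-cong : ∀ xs {f g} → (∀ x → x ∈ xs → f x ≡ g x) → avg xs f ≡ avg xs g
    avg-cong xs {f} {g} f≡g = begin
      avg xs f            ≡⟨ avg≡∑*weight xs f ⟩
      ∑ xs f * weight xs  ≡⟨ cong (_* weight xs) (∑-cong xs f≡g) ⟩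
      ∑ xs g * weight xs  ≡⟨ avg≡∑*weight xs g ⟨
      avg xs g            ∎
      where open ≡-Reasoning

    avg-mono : ∀ xs {f g} → (∀ x → f x ≤ g x) → avg xs f ≤ avg xs g
    avg-mono xs {f} {g} f≤g = subst₂ _≤_ (sym (avg≡∑*weight xs f)) (sym (avg≡∑*weight xs g))
      (*-monoʳ-≤-nonNeg (weight xs) {{nonNegative (weight-nonNeg xs)}} (∑-mono xs f≤g))

    avg-+ : ∀ xs f g → avg xs (λ x → f x + g x) ≡ avg xs f + avg xs g
    avg-+ xs f g = begin
      avg xs (λ x → f x + g x)                 ≡⟨ avg≡∑*weight xs _ ⟩
      ∑ xs (λ x → f x + g x) * weight xs       ≡⟨ cong (_* weight xs) (∑-+ xs f g) ⟩
      (∑ xs f + ∑ xs g) * weight xs            ≡⟨ *-distribʳ-+ (weight xs) (∑ xs f) (∑ xs g) ⟩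
      ∑ xs f * weight xs + ∑ xs g * weight xs  ≡⟨ cong₂ _+_ (avg≡∑*weight xs f) (avg≡∑*weight xs g) ⟨
      avg xs f + avg xs g                      ∎
      where open ≡-Reasoning

    avg-*ˡ : ∀ xs a f → avg xs (λ x → a * f x) ≡ a * avg xs f
    avg-*ˡ xs a f = begin
      avg xs (λ x → a * f x)            ≡⟨ avg≡∑*weight xs _ ⟩
      ∑ xs (λ x → a * f x) * weight xs  ≡⟨ cong (_* weight xs) (∑-*ˡ xs a f) ⟩
      a * ∑ xs f * weight xs            ≡⟨ *-assoc a (∑ xs f) (weight xs) ⟩
      a * (∑ xs f * weight xs)          ≡⟨ cong (a *_) (avg≡∑*weight xs f) ⟨
      a * avg xs f                      ∎
      where open ≡-Reasoning

    avg-const : ∀ {xs y} → y ∈ xs → ∀ a → avg xs (λ _ → a) ≡ a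
    avg-const {x ∷ xs} _ a = begin
      ∑ (x ∷ xs) (λ _ → a) * w  ≡⟨ cong (_* w) (∑-const (x ∷ xs) a) ⟩
      ℓ * a * w                 ≡⟨ solve 3 (λ ℓ a w → ℓ :* a :* w := (ℓ :* w) :* a) refl ℓ a w ⟩
      ℓ * w * a                 ≡⟨ cong (_* a) (fromℕ-inverse (length xs)) ⟩
      1ℚ * a                    ≡⟨ *-identityˡ a ⟩
      a                         ∎
      where
      open ≡-Reasoning
      ℓ = fromℕ (length (x ∷ xs))
      w = weight (x ∷ xs)

    ∑≡length*avg : ∀ xs f → ∑ xs f ≡ fromℕ (length xs) * avg xs f
    ∑≡length*avg []       f = sym (trans (cong (_* 0ℚ) fromℕ-0) (*-zeroˡ 0ℚ))
    ∑≡length*avg (x ∷ xs) f = begin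
      s              ≡⟨ *-identityʳ s ⟨
      s * 1ℚ         ≡⟨ cong (s *_) (fromℕ-inverse (length xs)) ⟨
      s * (ℓ * w)    ≡⟨ solve 3 (λ s ℓ w → s :* (ℓ :* w) := ℓ :* (s :* w)) refl s ℓ w ⟩
      ℓ * (s * w)    ∎
      where
      open ≡-Reasoning
      s = ∑ (x ∷ xs) f
      ℓ = fromℕ (length (x ∷ xs))
      w = weight (x ∷ xs)

    avg-zero : ∀ xs → avg xs (λ _ → 0ℚ) ≡ 0ℚ
    avg-zero xs = trans (avg-cong xs (λ _ _ → sym (*-zeroˡ 0ℚ)))
      (trans (avg-*ˡ xs 0ℚ (λ _ → 0ℚ)) (*-zeroˡ (avg xs (λ _ → 0ℚ))))

    avg-nonNeg : ∀ xs {f} → (∀ x → 0ℚ ≤ f x) → 0ℚ ≤ avg xs f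
    avg-nonNeg xs {f} 0≤f = subst (_≤ avg xs f) (avg-zero xs) (avg-mono xs 0≤f)

  ∑-map : ∀ {A B : Set} (g : A → B) xs f → ∑ (map g xs) f ≡ ∑ xs (λ x → f (g x))
  ∑-map g []       f = refl
  ∑-map g (x ∷ xs) f = cong (f (g x) +_) (∑-map g xs f)

  ∑-concatMap : ∀ {A B : Set} (F : A → List B) xs f → ∑ (concatMap F xs) f ≡ ∑ xs (λ x → ∑ (F x) f)
  ∑-concatMap F []       f = refl
  ∑-concatMap F (x ∷ xs) f =
    trans (∑-++ (F x) (concatMap F xs) f) (cong (∑ (F x) f +_) (∑-concatMap F xs f))

module Tuples where
  open import Data.Nat as ℕ using (ℕ; zero; suc; _^_)
  open import Data.Rational using (ℚ; _+_; _*_)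
  open import Data.Rational.Properties using (+-0-commutativeMonoid)
  open import Data.Fin using (Fin; zero; suc)
  open import Data.Fin.Permutation using (Permutation′; _⟨$⟩ʳ_)
  open import Data.List as List using (List; []; _∷_; length; map; concatMap; allFin)
  import Data.List.Properties as List
  open import Data.List.Membership.Propositional using (_∈_; lose)
  open import Data.List.Membership.Propositional.Properties using (∈-allFin; ∈-map⁺; ∈-concatMap⁺)
  open import Data.List.Relation.Unary.Any using (here)
  open import Data.Vec as Vec using (Vec; []; _∷_)
  open import Function using (_∘_; id)
  open import Relation.Binary.PropositionalEquality
  open import Algebra.Properties.CommutativeMonoid.Sum +-0-commutativeMonoid using (sum; sum-permute)
  open import Defs using (allTuples; avg)
  open FromNat
  open Averages

  ∈-allTuples : ∀ {n d} (v : Vec (Fin n) d) → v ∈ allTuples n d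
  ∈-allTuples          []      = here refl
  ∈-allTuples {n} {suc d} (a ∷ v) =
    ∈-concatMap⁺ (λ i → map (i ∷_) (allTuples n d)) (lose (∈-allFin a) (∈-map⁺ (a ∷_) (∈-allTuples v)))

  length-concatMap-const : ∀ {A B : Set} (F : A → List B) {k} → (∀ x → length (F x) ≡ k) →
                           ∀ xs → length (concatMap F xs) ≡ length xs ℕ.* k
  length-concatMap-const F |F|≡k []       = refl
  length-concatMap-const F |F|≡k (x ∷ xs) =
    trans (List.length-++ (F x)) (cong₂ ℕ._+_ (|F|≡k x) (length-concatMap-const F |F|≡k xs))

  length-allTuples : ∀ n d → length (allTuples n d) ≡ n ^ d
  length-allTuples n zero    = refl
  length-allTuples n (suc d) = begin
    length (allTuples n (suc d))  ≡⟨ length-concatMap-const _ |a∷allTuples|≡n^d (allFin n) ⟩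
    length (allFin n) ℕ.* n ^ d   ≡⟨ cong (ℕ._* n ^ d) (List.length-tabulate {n = n} id) ⟩
    n ^ suc d                     ∎
    where
    open ≡-Reasoning
    |a∷allTuples|≡n^d : ∀ a → length (map (a ∷_) (allTuples n d)) ≡ n ^ d
    |a∷allTuples|≡n^d a = trans (List.length-map (a ∷_) (allTuples n d)) (length-allTuples n d)

  ∑-allFin-const : ∀ n a → ∑ (allFin n) (λ _ → a) ≡ fromℕ n * a
  ∑-allFin-const n a = trans (∑-const (allFin n) a) (cong (λ k → fromℕ k * a) (List.length-tabulate {n = n} id))

  ∑-allTuples-suc : ∀ n d (F : Vec (Fin n) (suc d) → ℚ) →
                    ∑ (allTuples n (suc d)) F ≡ ∑ (allFin n) (λ a → ∑ (allTuples n d) (λ v → F (a ∷ v)))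
  ∑-allTuples-suc n d F = trans (∑-concatMap _ (allFin n) F)
    (∑-cong (allFin n) (λ a _ → ∑-map (a ∷_) (allTuples n d) F))

  ∑-tabulate : ∀ {n m} (g : Fin m → Fin n) (G : Fin n → ℚ) → ∑ (List.tabulate g) G ≡ sum (G ∘ g)
  ∑-tabulate {m = zero}  g G = refl
  ∑-tabulate {m = suc m} g G = cong (G (g zero) +_) (∑-tabulate (g ∘ suc) G)

  ∑-allFin-permute : ∀ {n} (π : Permutation′ n) (G : Fin n → ℚ) →
                     ∑ (allFin n) (λ a → G (π ⟨$⟩ʳ a)) ≡ ∑ (allFin n) G
  ∑-allFin-permute {n} π G = begin
    ∑ (allFin n) (G ∘ (π ⟨$⟩ʳ_))  ≡⟨ ∑-tabulate id (G ∘ (π ⟨$⟩ʳ_)) ⟩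
    sum (G ∘ (π ⟨$⟩ʳ_))           ≡⟨ sum-permute G π ⟨
    sum G                         ≡⟨ ∑-tabulate id G ⟨
    ∑ (allFin n) G                ∎
    where open ≡-Reasoning

  ∑-allTuples-permute : ∀ {n} d (π : Permutation′ n) (F : Vec (Fin n) d → ℚ) →
                        ∑ (allTuples n d) (λ v → F (Vec.map (π ⟨$⟩ʳ_) v)) ≡ ∑ (allTuples n d) F
  ∑-allTuples-permute         zero    π F = refl
  ∑-allTuples-permute {n} (suc d) π F = begin
    ∑ (allTuples n (suc d)) (F ∘ Vec.map σ)
      ≡⟨ ∑-allTuples-suc n d (F ∘ Vec.map σ) ⟩
    ∑ (allFin n) (λ a → ∑ (allTuples n d) (λ v → F (σ a ∷ Vec.map σ v)))
      ≡⟨ ∑-cong (allFin n) (λ a _ → ∑-allTuples-permute d π (F ∘ (σ a ∷_))) ⟩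
    ∑ (allFin n) (λ a → ∑ (allTuples n d) (λ v → F (σ a ∷ v)))
      ≡⟨ ∑-allFin-permute π (λ a → ∑ (allTuples n d) (F ∘ (a ∷_))) ⟩
    ∑ (allFin n) (λ a → ∑ (allTuples n d) (λ v → F (a ∷ v)))
      ≡⟨ ∑-allTuples-suc n d F ⟨
    ∑ (allTuples n (suc d)) F
      ∎
    where
    open ≡-Reasoning
    σ = π ⟨$⟩ʳ_

  avg-allTuples-permute : ∀ {n} d (π : Permutation′ n) (F : Vec (Fin n) d → ℚ) →
                          avg (allTuples n d) (λ v → F (Vec.map (π ⟨$⟩ʳ_) v)) ≡ avg (allTuples n d) F
  avg-allTuples-permute {n} d π F = begin
    avg tuples (F ∘ Vec.map (π ⟨$⟩ʳ_))                   ≡⟨ avg≡∑*weight tuples _ ⟩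
    ∑ tuples (F ∘ Vec.map (π ⟨$⟩ʳ_)) * weight tuples     ≡⟨ cong (_* weight tuples) (∑-allTuples-permute d π F) ⟩
    ∑ tuples F * weight tuples                           ≡⟨ avg≡∑*weight tuples F ⟨
    avg tuples F                                         ∎
    where
    open ≡-Reasoning
    tuples = allTuples n d

module Winners where
  open import Data.Nat as ℕ using (ℕ; suc; _≤_; _<_; _≤ᵇ_; z≤n)
  import Data.Nat.Properties as ℕ
  open import Data.Bool using (Bool; _∧_)
  open import Data.Bool.Properties using (T-∧)
  open import Data.Empty using (⊥-elim)
  open import Data.Fin using (Fin; _≟_)
  open import Data.Fin.Permutation.Components using (transpose)
  open import Data.List using (allFin)
  import Data.List.Membership.Propositional as List
  open import Data.List.Membership.Propositional.Properties using (∈-filter⁻; ∈-filter⁺; ∈-allFin)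
  open import Data.Product using (∃; _×_; _,_; proj₂)
  open import Data.Sum using (_⊎_; inj₁; inj₂)
  open import Data.Vec as Vec using (Vec; []; _∷_)
  open import Data.Vec.Membership.Propositional using (_∈_; find)
  open import Data.Vec.Membership.Propositional.Properties using (∈-map⁺)
  import Data.Vec.Membership.DecPropositional as DecMembership
  open import Data.Vec.Relation.Unary.Any using (here; there)
  import Data.Vec.Relation.Unary.Any.Properties as Any
  open import Function using (Equivalence; _∘_)
  open import Relation.Nullary using (yes; no; T?)
  open import Relation.Nullary.Decidable using (⌊_⌋; toWitness; fromWitness)
  open import Relation.Binary.PropositionalEquality
  open import Defs using (Loads; maxLoad; winners)

  transpose-matchʳ : ∀ {n} (i j : Fin n) → transpose i j j ≡ i
  transpose-matchʳ i j with j ≟ i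
  ... | yes j≡i = j≡i
  ... | no _ with j ≟ j
  ...   | yes _  = refl
  ...   | no j≢j = ⊥-elim (j≢j refl)

  transpose-∈ : ∀ {n d} {i j y : Fin n} {v : Vec (Fin n) d} →
                y ∈ v → j ∈ v → transpose i j y ≡ i ⊎ transpose i j y ∈ v
  transpose-∈ {i = i} {j} {y} y∈v j∈v with y ≟ i
  ... | yes _ = inj₂ j∈v
  ... | no _ with y ≟ j
  ...   | yes _ = inj₁ refl
  ...   | no _  = inj₂ y∈v

  ∈-map-transpose : ∀ {n d} {i j x : Fin n} {v : Vec (Fin n) d} →
                    x ∈ Vec.map (transpose i j) v → j ∈ v → x ≡ i ⊎ x ∈ v
  ∈-map-transpose x∈σv j∈v with find (Any.map⁻ x∈σv)
  ... | y , y∈v , refl = transpose-∈ y∈v j∈v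

  module _ {n : ℕ} (L : Loads n) where

    ≤-maxLoad : ∀ {d x} {v : Vec (Fin n) d} → x ∈ v → L x ≤ maxLoad L v
    ≤-maxLoad             (here refl) = ℕ.m≤m⊔n _ _
    ≤-maxLoad {v = y ∷ v} (there x∈v) = ℕ.≤-trans (≤-maxLoad x∈v) (ℕ.m≤n⊔m (L y) _)

    maxLoad-attained : ∀ {d} (v : Vec (Fin n) (suc d)) → ∃ λ x → x ∈ v × maxLoad L v ≤ L x
    maxLoad-attained (y ∷ []) = y , here refl , ℕ.⊔-lub ℕ.≤-refl z≤n
    maxLoad-attained (y ∷ v@(_ ∷ _)) with maxLoad-attained v | ℕ.≤-total (L y) (maxLoad L v)
    ... | x , x∈v , max≤Lx | inj₁ Ly≤max = x , there x∈v , ℕ.⊔-lub (ℕ.≤-trans Ly≤max max≤Lx) max≤Lx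
    ... | _ , _   , _      | inj₂ max≤Ly = y , here refl , ℕ.⊔-lub ℕ.≤-refl max≤Ly

    isWinner : ∀ {d} → Vec (Fin n) d → Fin n → Bool
    isWinner v i = ⌊ DecMembership._∈?_ (_≟_ {n}) i v ⌋ ∧ (maxLoad L v ≤ᵇ L i)

    ∈-winners⁻ : ∀ {d x} (v : Vec (Fin n) d) → x List.∈ winners L v → x ∈ v × maxLoad L v ≤ L x
    ∈-winners⁻ {x = x} v x-wins with Equivalence.to (T-∧ {⌊ x∈?v ⌋})
                                      (proj₂ (∈-filter⁻ (T? ∘ isWinner v) {xs = allFin n} x-wins))
      where x∈?v = DecMembership._∈?_ (_≟_ {n}) x v
    ... | x∈v , max≤ᵇLx = toWitness x∈v , ℕ.≤ᵇ⇒≤ (maxLoad L v) (L x) max≤ᵇLx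

    ∈-winners⁺ : ∀ {d x} {v : Vec (Fin n) d} → x ∈ v → maxLoad L v ≤ L x → x List.∈ winners L v
    ∈-winners⁺ {x = x} {v} x∈v max≤Lx = ∈-filter⁺ (T? ∘ isWinner v) (∈-allFin x)
      (Equivalence.from (T-∧ {⌊ x∈?v ⌋}) (fromWitness {a? = x∈?v} x∈v , ℕ.≤⇒≤ᵇ max≤Lx))
      where x∈?v = DecMembership._∈?_ (_≟_ {n}) x v

    winners-nonEmpty : ∀ {d} (v : Vec (Fin n) (suc d)) → ∃ λ x → x List.∈ winners L v
    winners-nonEmpty v with maxLoad-attained v
    ... | x , x∈v , max≤Lx = x , ∈-winners⁺ x∈v max≤Lx

    winners-transpose : ∀ {d i j x} (v : Vec (Fin n) d) → L j < L i → j List.∈ winners L v →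
                        x List.∈ winners L (Vec.map (transpose i j) v) → x ≡ i
    winners-transpose {i = i} {j} {x} v Lj<Li j-wins x-wins
      with ∈-winners⁻ v j-wins | ∈-winners⁻ (Vec.map (transpose i j) v) x-wins
    ... | j∈v , max≤Lj | x∈σv , maxσ≤Lx with ∈-map-transpose x∈σv j∈v
    ...   | inj₁ x≡i = x≡i
    ...   | inj₂ x∈v = ⊥-elim (ℕ.<-irrefl refl (begin-strict
      L x                                    ≤⟨ ≤-maxLoad x∈v ⟩
      maxLoad L v                            ≤⟨ max≤Lj ⟩
      L j                                    <⟨ Lj<Li ⟩
      L i                                    ≡⟨ cong L (transpose-matchʳ i j) ⟨
      L (transpose i j j)                    ≤⟨ ≤-maxLoad (∈-map⁺ (transpose i j) j∈v) ⟩
      maxLoad L (Vec.map (transpose i j) v)  ≤⟨ maxσ≤Lx ⟩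
      L x                                    ∎))
      where open ℕ.≤-Reasoning

module BallPlacement where
  open import Data.Nat as ℕ using (ℕ; suc; _^_; _<_)
  open import Data.Bool using (if_then_else_)
  open import Data.Rational using (ℚ; 0ℚ; 1ℚ; _+_; _*_; _≤_)
  open import Data.Rational.Properties using (≤-refl; nonNegative⁻¹; module ≤-Reasoning)
  open import Data.Fin using (Fin; _≟_)
  import Data.Fin.Permutation as Permutation
  open import Data.Fin.Permutation.Components using (transpose)
  open import Data.List using (List; []; _∷_; length)
  open import Data.List.Membership.Propositional using (lose) renaming (_∈_ to _∈ˡ_)
  import Data.List.Membership.DecPropositional as DecMembership
  open import Data.Product using (proj₁; proj₂)
  open import Data.Vec as Vec using (Vec; replicate)
  open import Data.Vec.Membership.Propositional using (_∈_)
  open import Data.Vec.Relation.Unary.Any using (here; there)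
  open import Relation.Nullary using (yes; no; contradiction)
  open import Relation.Nullary.Decidable using (⌊_⌋)
  open import Relation.Binary.PropositionalEquality
  open import Defs using (Loads; avg; allTuples; winners)
  open RationalOrder
  open FromNat
  open Averages
  open Tuples
  open Winners

  δ : ∀ {n} → Fin n → Fin n → ℚ
  δ i c = if ⌊ i ≟ c ⌋ then 1ℚ else 0ℚ

  δ-self : ∀ {n} (i : Fin n) → δ i i ≡ 1ℚ
  δ-self i with i ≟ i
  ... | yes _  = refl
  ... | no i≢i = contradiction refl i≢i

  δ-≢ : ∀ {n} {i c : Fin n} → i ≢ c → δ i c ≡ 0ℚ
  δ-≢ {i = i} {c} i≢c with i ≟ c
  ... | yes i≡c = contradiction i≡c i≢c
  ... | no _    = refl

  δ-nonNeg : ∀ {n} (i c : Fin n) → 0ℚ ≤ δ i c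
  δ-nonNeg i c with i ≟ c
  ... | yes _ = nonNegative⁻¹ 1ℚ
  ... | no _  = ≤-refl

  δ≤1 : ∀ {n} (i c : Fin n) → δ i c ≤ 1ℚ
  δ≤1 i c with i ≟ c
  ... | yes _ = ≤-refl
  ... | no _  = nonNegative⁻¹ 1ℚ

  data AtMostOneHit : ℚ → ℚ → Set where
    hitFirst   : AtMostOneHit 1ℚ 0ℚ
    hitSecond  : AtMostOneHit 0ℚ 1ℚ
    hitNeither : AtMostOneHit 0ℚ 0ℚ

  δ-atMostOneHit : ∀ {n} {i j : Fin n} → i ≢ j → ∀ c → AtMostOneHit (δ i c) (δ j c)
  δ-atMostOneHit {i = i} {j} i≢j c with i ≟ c | j ≟ c
  ... | yes refl | yes refl = contradiction refl i≢j
  ... | yes refl | no _     = hitFirst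
  ... | no _     | yes refl = hitSecond
  ... | no _     | no _     = hitNeither

  ∈-replicate⁻ : ∀ {A : Set} {d} {x y : A} → x ∈ replicate d y → x ≡ y
  ∈-replicate⁻ {d = suc d} (here x≡y)   = x≡y
  ∈-replicate⁻ {d = suc d} (there x∈ys) = ∈-replicate⁻ x∈ys

  -- Option tuples have length suc d. 𝔼 L f is the expectation of f at the bin that receives
  -- the next ball from loads L; it is literally the operator in the recursion of failProb.
  module _ {n d : ℕ} (L : Loads n) where

    private
      tuples = allTuples n (suc d)

    𝔼 : (Fin n → ℚ) → ℚ
    𝔼 f = avg tuples (λ v → avg (winners L v) f)

    share : Fin n → Vec (Fin n) (suc d) → ℚ
    share i v = avg (winners L v) (δ i)

    chance : Fin n → ℚ
    chance i = 𝔼 (δ i)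

    𝔼-cong : ∀ {f g} → (∀ c → f c ≡ g c) → 𝔼 f ≡ 𝔼 g
    𝔼-cong f≡g = avg-cong tuples (λ v _ → avg-cong (winners L v) (λ c _ → f≡g c))

    𝔼-mono : ∀ {f g} → (∀ c → f c ≤ g c) → 𝔼 f ≤ 𝔼 g
    𝔼-mono f≤g = avg-mono tuples (λ v → avg-mono (winners L v) f≤g)

    𝔼-+ : ∀ f g → 𝔼 (λ c → f c + g c) ≡ 𝔼 f + 𝔼 g
    𝔼-+ f g = trans (avg-cong tuples (λ v _ → avg-+ (winners L v) f g)) (avg-+ tuples _ _)

    𝔼-*ˡ : ∀ a f → 𝔼 (λ c → a * f c) ≡ a * 𝔼 f
    𝔼-*ˡ a f = trans (avg-cong tuples (λ v _ → avg-*ˡ (winners L v) a f)) (avg-*ˡ tuples a _)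

    𝔼-zero : 𝔼 (λ _ → 0ℚ) ≡ 0ℚ
    𝔼-zero = trans (avg-cong tuples (λ v _ → avg-zero (winners L v))) (avg-zero tuples)

    𝔼-const : Fin n → ∀ a → 𝔼 (λ _ → a) ≡ a
    𝔼-const i a = trans (avg-cong tuples (λ v _ → avg-const (proj₂ (winners-nonEmpty L v)) a))
                        (avg-const (∈-allTuples (replicate (suc d) i)) a)

    𝔼-∑ : ∀ {B : Set} (xs : List B) (h : B → Fin n → ℚ) → 𝔼 (λ c → ∑ xs (λ x → h x c)) ≡ ∑ xs (λ x → 𝔼 (h x))
    𝔼-∑ []       h = 𝔼-zero
    𝔼-∑ (x ∷ xs) h = trans (𝔼-+ (h x) _) (cong (𝔼 (h x) +_) (𝔼-∑ xs h))

    share≡1 : ∀ {i} v → (∀ x → x ∈ˡ winners L v → x ≡ i) → share i v ≡ 1ℚ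
    share≡1 {i} v only-i =
      trans (avg-cong (winners L v) (λ x x-wins → trans (cong (δ i) (only-i x x-wins)) (δ-self i)))
            (avg-const (proj₂ (winners-nonEmpty L v)) 1ℚ)

    1≤n^D*chance : ∀ i → 1ℚ ≤ fromℕ (n ^ suc d) * chance i
    1≤n^D*chance i = begin
      1ℚ
        ≡⟨ share≡1 all-i (λ x x-wins → ∈-replicate⁻ (proj₁ (∈-winners⁻ L all-i x-wins))) ⟨
      share i all-i
        ≤⟨ ∑-≥-Any (λ v → avg-nonNeg (winners L v) (δ-nonNeg i)) (lose (∈-allTuples all-i) ≤-refl) ⟩
      ∑ tuples (share i)
        ≡⟨ ∑≡length*avg tuples (share i) ⟩
      fromℕ (length tuples) * chance i
        ≡⟨ cong (λ k → fromℕ k * chance i) (length-allTuples n (suc d)) ⟩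
      fromℕ (n ^ suc d) * chance i
        ∎
      where
      open ≤-Reasoning
      all-i = replicate (suc d) i

    -- Coupling: transposing i and j maps every tuple won by j to a tuple won by i alone.
    share-transpose : ∀ {i j} → L j < L i → ∀ v → share j v ≤ share i (Vec.map (transpose i j) v)
    share-transpose {i} {j} Lj<Li v with DecMembership._∈?_ _≟_ j (winners L v)
    ... | yes j-wins = begin
      share j v                          ≤⟨ avg-mono (winners L v) (δ≤1 j) ⟩
      avg (winners L v) (λ _ → 1ℚ)       ≡⟨ avg-const j-wins 1ℚ ⟩
      1ℚ                                 ≡⟨ share≡1 (Vec.map (transpose i j) v) (λ x → winners-transpose L v Lj<Li j-wins) ⟨
      share i (Vec.map (transpose i j) v) ∎
      where open ≤-Reasoning
    ... | no j-loses = begin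
      share j v                          ≡⟨ avg-cong (winners L v) (λ x x-wins → δ-≢ (λ { refl → j-loses x-wins })) ⟩
      avg (winners L v) (λ _ → 0ℚ)       ≡⟨ avg-zero (winners L v) ⟩
      0ℚ                                 ≤⟨ avg-nonNeg (winners L (Vec.map (transpose i j) v)) (δ-nonNeg i) ⟩
      share i (Vec.map (transpose i j) v) ∎
      where open ≤-Reasoning

    chance-nonNeg : ∀ i → 0ℚ ≤ chance i
    chance-nonNeg i = subst (_≤ chance i) 𝔼-zero (𝔼-mono (δ-nonNeg i))

    chance-mono : ∀ {i j} → L j < L i → chance j ≤ chance i
    chance-mono {i} {j} Lj<Li = begin
      chance j                                               ≤⟨ avg-mono tuples (share-transpose Lj<Li) ⟩
      avg tuples (λ v → share i (Vec.map (transpose i j) v)) ≡⟨ avg-allTuples-permute (suc d) (Permutation.transpose i j) (share i) ⟩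
      chance i                                               ∎
      where open ≤-Reasoning

module GapDrift where
  open import Data.Nat as ℕ using (ℕ; zero; suc; _^_)
  import Data.Nat.Properties as ℕ
  open import Data.Rational using (ℚ; 0ℚ; 1ℚ; _+_; _*_; _-_; _≤_)
  open import Data.Rational.Properties
    using (≤-refl; +-inverseʳ; *-zeroˡ; +-identityʳ; +-comm; nonNegative⁻¹; module ≤-Reasoning)
  open import Data.Rational.Solver
  open import Data.Fin using (Fin; _≟_)
  open import Data.Sum using (inj₁; inj₂)
  open import Relation.Binary using (tri<; tri≈; tri>)
  open import Relation.Nullary using (yes; no)
  open import Relation.Binary.PropositionalEquality
  open import Defs using (Loads; place; dist)
  open +-*-Solver
  open RationalOrder
  open FromNat
  open BallPlacement

  sq : ℚ → ℚ
  sq x = x * x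

  two : ℚ
  two = 1ℚ + 1ℚ

  sq-hits : ∀ {x y} → AtMostOneHit x y → sq (x - y) ≡ x + y
  sq-hits hitFirst   = refl
  sq-hits hitSecond  = refl
  sq-hits hitNeither = refl

  sq-shift : ∀ a b {x y} → AtMostOneHit x y →
             sq ((a + x) - (b + y)) ≡ sq (a - b) + (two * (a - b) + 1ℚ) * x + (1ℚ - two * (a - b)) * y
  sq-shift a b {x} {y} hits = begin
    sq ((a + x) - (b + y))                                            ≡⟨ expand a b x y ⟩
    sq (a - b) + two * (a - b) * (x - y) + sq (x - y)                 ≡⟨ cong (sq (a - b) + two * (a - b) * (x - y) +_) (sq-hits hits) ⟩
    sq (a - b) + two * (a - b) * (x - y) + (x + y)                    ≡⟨ regroup a b x y ⟩
    sq (a - b) + (two * (a - b) + 1ℚ) * x + (1ℚ - two * (a - b)) * y  ∎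
    where
    open ≡-Reasoning
    expand = solve 4 (λ a b x y → ((a :+ x) :- (b :+ y)) :* ((a :+ x) :- (b :+ y))
                                  := (a :- b) :* (a :- b) :+ con two :* (a :- b) :* (x :- y) :+ (x :- y) :* (x :- y)) refl
    regroup = solve 4 (λ a b x y → (a :- b) :* (a :- b) :+ con two :* (a :- b) :* (x :- y) :+ (x :+ y)
                                   := (a :- b) :* (a :- b) :+ (con two :* (a :- b) :+ con 1ℚ) :* x
                                      :+ (con 1ℚ :- con two :* (a :- b)) :* y) refl

  0≤[a-b]*[p-q] : ∀ {a b : ℕ} {p q : ℚ} → (b ℕ.< a → q ≤ p) → (a ℕ.< b → p ≤ q) →
                  0ℚ ≤ (fromℕ a - fromℕ b) * (p - q)
  0≤[a-b]*[p-q] {a} {b} {p} {q} b<a⇒q≤p a<b⇒p≤q with ℕ.<-cmp a b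
  ... | tri< a<b _ _  = subst (0ℚ ≤_) (flip-signs (fromℕ a) (fromℕ b) p q)
                          (*-nonNeg (p≤q⇒0≤q-p (fromℕ-mono-≤ (ℕ.<⇒≤ a<b))) (p≤q⇒0≤q-p (a<b⇒p≤q a<b)))
    where flip-signs = solve 4 (λ a b p q → (b :- a) :* (q :- p) := (a :- b) :* (p :- q)) refl
  ... | tri≈ _ refl _ = subst (0ℚ ≤_) (sym (trans (cong (_* (p - q)) (+-inverseʳ (fromℕ a))) (*-zeroˡ (p - q)))) ≤-refl
  ... | tri> _ _ b<a  = *-nonNeg (p≤q⇒0≤q-p (fromℕ-mono-≤ (ℕ.<⇒≤ b<a))) (p≤q⇒0≤q-p (b<a⇒q≤p b<a))

  dist≡∣-∣ : ∀ a b → dist a b ≡ ℕ.∣ a - b ∣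
  dist≡∣-∣ a b with ℕ.≤-total a b
  ... | inj₁ a≤b = trans (cong (ℕ._+ (b ℕ.∸ a)) (ℕ.m≤n⇒m∸n≡0 a≤b)) (sym (ℕ.m≤n⇒∣m-n∣≡n∸m a≤b))
  ... | inj₂ b≤a = trans (cong ((a ℕ.∸ b) ℕ.+_) (ℕ.m≤n⇒m∸n≡0 b≤a))
                         (trans (ℕ.+-identityʳ (a ℕ.∸ b)) (sym (trans (ℕ.∣-∣-comm a b) (ℕ.m≤n⇒∣m-n∣≡n∸m b≤a))))

  ∣1+m-m∣≡1 : ∀ m → ℕ.∣ suc m - m ∣ ≡ 1
  ∣1+m-m∣≡1 zero    = refl
  ∣1+m-m∣≡1 (suc m) = ∣1+m-m∣≡1 m

  ∣1+m-n∣≤1+∣m-n∣ : ∀ m n → ℕ.∣ suc m - n ∣ ℕ.≤ suc ℕ.∣ m - n ∣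
  ∣1+m-n∣≤1+∣m-n∣ m n =
    subst (λ k → ℕ.∣ suc m - n ∣ ℕ.≤ k ℕ.+ ℕ.∣ m - n ∣) (∣1+m-m∣≡1 m) (ℕ.∣-∣-triangle (suc m) m n)

  ∣m-1+n∣≤1+∣m-n∣ : ∀ m n → ℕ.∣ m - suc n ∣ ℕ.≤ suc ℕ.∣ m - n ∣
  ∣m-1+n∣≤1+∣m-n∣ m n =
    subst₂ (λ a b → a ℕ.≤ suc b) (ℕ.∣-∣-comm (suc n) m) (ℕ.∣-∣-comm n m) (∣1+m-n∣≤1+∣m-n∣ n m)

  ∣-∣-place : ∀ {n} (L : Loads n) c i j → ℕ.∣ place L c i - place L c j ∣ ℕ.≤ suc ℕ.∣ L i - L j ∣
  ∣-∣-place L c i j with i ≟ c | j ≟ c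
  ... | yes _ | yes _ = ℕ.n≤1+n ℕ.∣ L i - L j ∣
  ... | yes _ | no _  = ∣1+m-n∣≤1+∣m-n∣ (L i) (L j)
  ... | no _  | yes _ = ∣m-1+n∣≤1+∣m-n∣ (L i) (L j)
  ... | no _  | no _  = ℕ.n≤1+n ℕ.∣ L i - L j ∣

  fromℕ-∣-∣² : ∀ a b → fromℕ (ℕ.∣ a - b ∣ ℕ.* ℕ.∣ a - b ∣) ≡ sq (fromℕ a - fromℕ b)
  fromℕ-∣-∣² a b with ℕ.≤-total a b
  ... | inj₁ a≤b rewrite ℕ.m≤n⇒∣m-n∣≡n∸m a≤b =
    trans (fromℕ-* (b ℕ.∸ a) (b ℕ.∸ a)) (trans (cong sq (fromℕ-∸ a≤b))
      (solve 2 (λ a b → (b :- a) :* (b :- a) := (a :- b) :* (a :- b)) refl (fromℕ a) (fromℕ b)))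
  ... | inj₂ b≤a rewrite ℕ.∣-∣-comm a b | ℕ.m≤n⇒∣m-n∣≡n∸m b≤a =
    trans (fromℕ-* (a ℕ.∸ b) (a ℕ.∸ b)) (cong sq (fromℕ-∸ b≤a))

  gap : ∀ {n} → Loads n → Fin n → Fin n → ℚ
  gap L i j = fromℕ (L i) - fromℕ (L j)

  fromℕ-place : ∀ {n} (L : Loads n) c x → fromℕ (place L c x) ≡ fromℕ (L x) + δ x c
  fromℕ-place L c x with x ≟ c
  ... | yes _ = trans (fromℕ-suc (L x)) (+-comm 1ℚ (fromℕ (L x)))
  ... | no _  = sym (+-identityʳ (fromℕ (L x)))

  sq-gap-place : ∀ {n} (L : Loads n) {i j} → i ≢ j → ∀ c →
                 sq (gap (place L c) i j) ≡ sq (gap L i j) + (two * gap L i j + 1ℚ) * δ i c + (1ℚ - two * gap L i j) * δ j c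
  sq-gap-place L {i} {j} i≢j c = trans (cong sq (cong₂ _-_ (fromℕ-place L c i) (fromℕ-place L c j)))
                                       (sq-shift (fromℕ (L i)) (fromℕ (L j)) (δ-atMostOneHit i≢j c))

  module _ {n d : ℕ} (L : Loads n) {i j : Fin n} (i≢j : i ≢ j) where

    private
      g  = gap L i j
      a  = two * g + 1ℚ
      b  = 1ℚ - two * g
      N  = fromℕ (n ^ suc d)
      pᵢ = chance {d = d} L i
      pⱼ = chance {d = d} L j

    𝔼-sq-gap : 𝔼 {d = d} L (λ c → sq (gap (place L c) i j)) ≡ sq g + a * pᵢ + b * pⱼ
    𝔼-sq-gap = begin
      𝔼 L (λ c → sq (gap (place L c) i j))                   ≡⟨ 𝔼-cong L (sq-gap-place L i≢j) ⟩
      𝔼 L (λ c → sq g + a * δ i c + b * δ j c)              ≡⟨ 𝔼-+ L _ _ ⟩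
      𝔼 L (λ c → sq g + a * δ i c) + 𝔼 L (λ c → b * δ j c)  ≡⟨ cong₂ _+_ (𝔼-+ L _ _) (𝔼-*ˡ L b (δ j)) ⟩
      𝔼 L (λ _ → sq g) + 𝔼 L (λ c → a * δ i c) + b * pⱼ     ≡⟨ cong (_+ b * pⱼ) (cong₂ _+_ (𝔼-const L i (sq g)) (𝔼-*ˡ L a (δ i))) ⟩
      sq g + a * pᵢ + b * pⱼ                                ∎
      where open ≡-Reasoning

    sq-gap-drift : N * sq g + 1ℚ ≤ N * 𝔼 {d = d} L (λ c → sq (gap (place L c) i j))
    sq-gap-drift = begin
      N * sq g + 1ℚ                                                               ≤⟨ p≤p+q surplus-nonNeg ⟩
      (N * sq g + 1ℚ) + ((N * pᵢ - 1ℚ) + N * pⱼ + two * (N * (g * (pᵢ - pⱼ))))  ≡⟨ rearrange N g pᵢ pⱼ ⟩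
      N * (sq g + a * pᵢ + b * pⱼ)                                                ≡⟨ cong (N *_) 𝔼-sq-gap ⟨
      N * 𝔼 L (λ c → sq (gap (place L c) i j))                                    ∎
      where
      open ≤-Reasoning
      rearrange = solve 4 (λ N g p q → (N :* (g :* g) :+ con 1ℚ) :+ ((N :* p :- con 1ℚ) :+ N :* q :+ con two :* (N :* (g :* (p :- q))))
                                       := N :* (g :* g :+ (con two :* g :+ con 1ℚ) :* p :+ (con 1ℚ :- con two :* g) :* q)) refl
      surplus-nonNeg : 0ℚ ≤ (N * pᵢ - 1ℚ) + N * pⱼ + two * (N * (g * (pᵢ - pⱼ)))
      surplus-nonNeg = +-nonNeg (+-nonNeg (p≤q⇒0≤q-p (1≤n^D*chance L i)) (*-nonNeg (fromℕ-nonNeg _) (chance-nonNeg L j)))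
                                (*-nonNeg (nonNegative⁻¹ two) (*-nonNeg (fromℕ-nonNeg _) (0≤[a-b]*[p-q] (chance-mono L) (chance-mono L))))

module BooleanTests where
  open import Data.Nat as ℕ using (ℕ; _≤ᵇ_)
  import Data.Nat.Properties as ℕ
  open import Data.Bool using (true; false; T)
  open import Data.Bool.ListAction using (and)
  open import Data.List using (_∷_)
  open import Data.List.Relation.Unary.Any using (Any; here; there)
  open import Data.Unit using (tt)
  open import Relation.Binary.PropositionalEquality

  ≤ᵇ≡true⇒≤ : ∀ {a b} → (a ≤ᵇ b) ≡ true → a ℕ.≤ b
  ≤ᵇ≡true⇒≤ {a} {b} a≤ᵇb = ℕ.≤ᵇ⇒≤ a b (subst T (sym a≤ᵇb) tt)

  ≤ᵇ≡false⇒> : ∀ {a b} → (a ≤ᵇ b) ≡ false → b ℕ.< a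
  ≤ᵇ≡false⇒> a≰ᵇb = ℕ.≰⇒> (λ a≤b → subst T a≰ᵇb (ℕ.≤⇒≤ᵇ a≤b))

  and≡false⇒Any : ∀ bs → and bs ≡ false → Any (_≡ false) bs
  and≡false⇒Any (false ∷ bs) _      = here refl
  and≡false⇒Any (true ∷ bs)  and≡ff = there (and≡false⇒Any bs and≡ff)

module PairPotential (n d T : ℕ) where
  open import Data.Nat as ℕ using (ℕ; zero; suc; _^_; _≤ᵇ_)
  import Data.Nat.Properties as ℕ
  open import Data.Bool using (Bool; true; false; _∨_; _∧_; if_then_else_)
  open import Data.Bool.Properties using (∨-conicalˡ; ∨-conicalʳ; ∨-assoc; T-not-≡)
  open import Data.Rational using (ℚ; 0ℚ; 1ℚ; _+_; _*_; _-_; -_; _≤_)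
  open import Data.Rational.Properties
    using (≤-refl; ≤-trans; ≤-reflexive; +-comm; +-mono-≤; +-identityˡ; *-comm; *-zeroˡ; *-identityˡ; module ≤-Reasoning)
  open import Data.Rational.Solver
  open import Data.Fin using (Fin; _≟_)
  open import Data.Fin.Properties using (nonZeroIndex)
  open import Data.List using (allFin; map; concatMap)
  import Data.List.Relation.Unary.Any as Any
  import Data.List.Relation.Unary.Any.Properties as Any
  open import Function using (Equivalence; _∘_)
  open import Relation.Nullary using (contradiction)
  open import Relation.Nullary.Decidable using (⌊_⌋; toWitnessFalse)
  open import Relation.Binary.PropositionalEquality
  open import Defs using (Loads; Gaps; update; place; dist; allPairsDone; failProb)
  open +-*-Solver
  open RationalOrder
  open FromNat
  open Averages
  open Tuples
  open BallPlacement
  open GapDrift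
  open BooleanTests

  N K : ℕ
  N = n ^ suc d
  K = n ℕ.* n ℕ.* (n ℕ.* n)

  pairDone : ℕ → Loads n → Gaps n → Fin n → Fin n → Bool
  pairDone t L G i j = ⌊ i ≟ j ⌋ ∨ update n T t L G i j

  slack : Loads n → Fin n → Fin n → ℚ
  slack L i j = fromℕ N * (fromℕ K - sq (gap L i j))

  budget : ℕ → Loads n → Fin n → Fin n → ℚ
  budget t L i j = fromℕ t + slack L i j

  -- T + 1 times the potential of a pair, scaled so that no division occurs: until the horizon
  -- the budget pays for the expected growth of gap², afterwards an unfinished pair is charged 1.
  potential : (done early : Bool) → ℚ → ℚ
  potential true  _     _ = 0ℚ
  potential false true  b = b
  potential false false _ = fromℕ (suc T)

  Φ : ℕ → Loads n → Gaps n → Fin n → Fin n → ℚ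
  Φ t L G i j = potential (pairDone t L G i j) (t ≤ᵇ T) (budget t L i j)

  Ψ : ℕ → Loads n → Gaps n → ℚ
  Ψ t L G = ∑ (allFin n) (λ i → ∑ (allFin n) (Φ t L G i))

  module _ (t : ℕ) (L : Loads n) (G : Gaps n) (i j : Fin n) where

    undone⇒≢ : pairDone t L G i j ≡ false → i ≢ j
    undone⇒≢ undone = toWitnessFalse {a? = i ≟ j} (Equivalence.from T-not-≡ (∨-conicalˡ ⌊ i ≟ j ⌋ _ undone))

    undone-early⇒∣-∣<n² : pairDone t L G i j ≡ false → (t ≤ᵇ T) ≡ true → ℕ.∣ L i - L j ∣ ℕ.< n ℕ.* n
    undone-early⇒∣-∣<n² undone early = subst (ℕ._< n ℕ.* n) (dist≡∣-∣ (L i) (L j)) (≤ᵇ≡false⇒> gap-unseen)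
      where
      gap-unseen : (n ℕ.* n ≤ᵇ dist (L i) (L j)) ≡ false
      gap-unseen = subst (λ e → (e ∧ (n ℕ.* n ≤ᵇ dist (L i) (L j))) ≡ false) early
                         (∨-conicalʳ (G i j) _ (∨-conicalʳ ⌊ i ≟ j ⌋ _ undone))

    done-persists : pairDone t L G i j ≡ true → ∀ L′ → pairDone (suc t) L′ (update n T t L G) i j ≡ true
    done-persists done L′ = trans (sym (∨-assoc ⌊ i ≟ j ⌋ (update n T t L G i j) _)) (cong (_∨ _) done)

  slack≡fromℕ : ∀ L i j → ℕ.∣ L i - L j ∣ ℕ.≤ n ℕ.* n →
                slack L i j ≡ fromℕ (N ℕ.* (K ℕ.∸ ℕ.∣ L i - L j ∣ ℕ.* ℕ.∣ L i - L j ∣))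
  slack≡fromℕ L i j ≤n² = begin
    fromℕ N * (fromℕ K - sq (gap L i j))   ≡⟨ cong (λ x → fromℕ N * (fromℕ K - x)) (fromℕ-∣-∣² (L i) (L j)) ⟨
    fromℕ N * (fromℕ K - fromℕ (e ℕ.* e))  ≡⟨ cong (fromℕ N *_) (fromℕ-∸ (ℕ.*-mono-≤ ≤n² ≤n²)) ⟨
    fromℕ N * fromℕ (K ℕ.∸ e ℕ.* e)        ≡⟨ fromℕ-* N _ ⟨
    fromℕ (N ℕ.* (K ℕ.∸ e ℕ.* e))          ∎
    where
    open ≡-Reasoning
    e = ℕ.∣ L i - L j ∣

  slack-nonNeg : ∀ L i j → ℕ.∣ L i - L j ∣ ℕ.≤ n ℕ.* n → 0ℚ ≤ slack L i j
  slack-nonNeg L i j ≤n² = subst (0ℚ ≤_) (sym (slack≡fromℕ L i j ≤n²)) (fromℕ-nonNeg _)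

  1≤slack : ∀ L i j → ℕ.∣ L i - L j ∣ ℕ.< n ℕ.* n → 1ℚ ≤ slack L i j
  1≤slack L i j <n² = subst₂ _≤_ fromℕ-1 (sym (slack≡fromℕ L i j (ℕ.<⇒≤ <n²)))
    (fromℕ-mono-≤ (ℕ.*-mono-≤ (ℕ.m^n>0 n (suc d)) (ℕ.m<n⇒0<n∸m (ℕ.*-mono-< <n² <n²))))
    where instance _ = nonZeroIndex i

  private
    potential-elim : ∀ (P : ℚ → Set) {done early x} →
                     (done ≡ true → P 0ℚ) → (done ≡ false → early ≡ true → P x) →
                     (done ≡ false → early ≡ false → P (fromℕ (suc T))) → P (potential done early x)
    potential-elim P {true}          p₀ _  _  = p₀ refl
    potential-elim P {false} {true}  _  p₁ _  = p₁ refl refl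
    potential-elim P {false} {false} _  _  p₂ = p₂ refl refl

  Φ-elim : ∀ (P : ℚ → Set) t L G i j →
           (pairDone t L G i j ≡ true → P 0ℚ) →
           (pairDone t L G i j ≡ false → (t ≤ᵇ T) ≡ true → P (budget t L i j)) →
           (pairDone t L G i j ≡ false → (t ≤ᵇ T) ≡ false → P (fromℕ (suc T))) → P (Φ t L G i j)
  Φ-elim P t L G i j = potential-elim P

  Φ-nonNeg : ∀ t L G i j → 0ℚ ≤ Φ t L G i j
  Φ-nonNeg t L G i j = Φ-elim (0ℚ ≤_) t L G i j
    (λ _ → ≤-refl)
    (λ undone early → +-nonNeg (fromℕ-nonNeg t)
                               (slack-nonNeg L i j (ℕ.<⇒≤ (undone-early⇒∣-∣<n² t L G i j undone early))))
    (λ _ _ → fromℕ-nonNeg (suc T))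

  Φ≤budget : ∀ t L G i j → 0ℚ ≤ slack L i j → Φ t L G i j ≤ budget t L i j
  Φ≤budget t L G i j 0≤slack = Φ-elim (_≤ budget t L i j) t L G i j
    (λ _ → +-nonNeg (fromℕ-nonNeg t) 0≤slack)
    (λ _ _ → ≤-refl)
    (λ _ late → ≤-trans (fromℕ-mono-≤ (≤ᵇ≡false⇒> late)) (p≤p+q 0≤slack))

  Φ-late : ∀ t L G i j → T ℕ.< t → Φ t L G i j ≤ fromℕ (suc T)
  Φ-late t L G i j T<t = Φ-elim (_≤ fromℕ (suc T)) t L G i j
    (λ _ → fromℕ-nonNeg (suc T))
    (λ _ early → contradiction (≤ᵇ≡true⇒≤ early) (ℕ.<⇒≱ T<t))
    (λ _ _ → ≤-refl)

  Φ-at-horizon : ∀ t L G i j → T ℕ.≤ t → pairDone t L G i j ≡ false → fromℕ (suc T) ≤ Φ t L G i j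
  Φ-at-horizon t L G i j T≤t undone = Φ-elim (fromℕ (suc T) ≤_) t L G i j
    (λ done → contradiction (trans (sym done) undone) λ ())
    (λ _ early → begin
      fromℕ (suc T)          ≡⟨ trans (fromℕ-suc T) (+-comm 1ℚ (fromℕ T)) ⟩
      fromℕ T + 1ℚ           ≤⟨ +-mono-≤ (fromℕ-mono-≤ T≤t) (1≤slack L i j (undone-early⇒∣-∣<n² t L G i j undone early)) ⟩
      fromℕ t + slack L i j  ∎)
    (λ _ _ → ≤-refl)
    where open ≤-Reasoning

  budget-drift : ∀ t L {i j} → i ≢ j → 𝔼 {d = d} L (λ c → budget (suc t) (place L c) i j) ≤ budget t L i j
  budget-drift t L {i} {j} i≢j = 0≤q-p⇒p≤q (subst (0ℚ ≤_) surplus (p≤q⇒0≤q-p (sq-gap-drift {n} {d} L i≢j)))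
    where
    open ≡-Reasoning
    N′ = fromℕ N
    K′ = fromℕ K
    x  = sq (gap L i j)
    X  = λ c → sq (gap (place L c) i j)
    E  = 𝔼 {d = d} L X
    next = fromℕ (suc t) + N′ * K′

    𝔼-budget : 𝔼 L (λ c → budget (suc t) (place L c) i j) ≡ next + (- N′) * E
    𝔼-budget = begin
      𝔼 L (λ c → fromℕ (suc t) + N′ * (K′ - X c))  ≡⟨ 𝔼-cong L (λ c → affine (fromℕ (suc t)) N′ K′ (X c)) ⟩
      𝔼 L (λ c → next + (- N′) * X c)              ≡⟨ 𝔼-+ L (λ _ → next) (λ c → (- N′) * X c) ⟩
      𝔼 L (λ _ → next) + 𝔼 L (λ c → (- N′) * X c)   ≡⟨ cong₂ _+_ (𝔼-const L i next) (𝔼-*ˡ L (- N′) X) ⟩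
      next + (- N′) * E                             ∎
      where affine = solve 4 (λ s N K y → s :+ N :* (K :- y) := (s :+ N :* K) :+ (:- N) :* y) refl

    surplus : N′ * E - (N′ * x + 1ℚ) ≡ budget t L i j - 𝔼 L (λ c → budget (suc t) (place L c) i j)
    surplus = begin
      N′ * E - (N′ * x + 1ℚ)                                       ≡⟨ rearrange (fromℕ t) N′ K′ x E ⟩
      budget t L i j - (((1ℚ + fromℕ t) + N′ * K′) + (- N′) * E)
                                                                   ≡⟨ cong (λ s → budget t L i j - ((s + N′ * K′) + (- N′) * E)) (fromℕ-suc t) ⟨
      budget t L i j - (next + (- N′) * E)                         ≡⟨ cong (λ e → budget t L i j - e) 𝔼-budget ⟨
      budget t L i j - 𝔼 L (λ c → budget (suc t) (place L c) i j)  ∎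
      where rearrange = solve 5 (λ t N K x E → N :* E :- (N :* x :+ con 1ℚ)
                                             := (t :+ N :* (K :- x)) :- (((con 1ℚ :+ t) :+ N :* K) :+ (:- N) :* E)) refl

  Φ-supermartingale : ∀ t L G i j → 𝔼 {d = d} L (λ c → Φ (suc t) (place L c) (update n T t L G) i j) ≤ Φ t L G i j
  Φ-supermartingale t L G i j = Φ-elim (𝔼 L Φ′ ≤_) t L G i j
    (λ done → ≤-reflexive (trans (𝔼-cong L (λ c → cong (λ b → potential b _ _) (done-persists t L G i j done (place L c))))
                                 (𝔼-zero L)))
    (λ undone early → let ∣-∣<n² = undone-early⇒∣-∣<n² t L G i j undone early in begin
      𝔼 L Φ′                                      ≤⟨ 𝔼-mono L (λ c → Φ≤budget (suc t) (place L c) G′ i j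
                                                        (slack-nonNeg (place L c) i j (ℕ.≤-trans (∣-∣-place L c i j) ∣-∣<n²))) ⟩
      𝔼 L (λ c → budget (suc t) (place L c) i j)  ≤⟨ budget-drift t L (undone⇒≢ t L G i j undone) ⟩
      budget t L i j                              ∎)
    (λ _ late → begin
      𝔼 L Φ′                                      ≤⟨ 𝔼-mono L (λ c → Φ-late (suc t) (place L c) G′ i j (ℕ.m<n⇒m<1+n (≤ᵇ≡false⇒> late))) ⟩
      𝔼 L (λ _ → fromℕ (suc T))                   ≡⟨ 𝔼-const L i (fromℕ (suc T)) ⟩
      fromℕ (suc T)                               ∎)
    where
    open ≤-Reasoning
    G′ = update n T t L G
    Φ′ = λ c → Φ (suc t) (place L c) G′ i j

  Ψ-nonNeg : ∀ t L G → 0ℚ ≤ Ψ t L G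
  Ψ-nonNeg t L G = ∑-nonNeg (allFin n) (λ i → ∑-nonNeg (allFin n) (Φ-nonNeg t L G i))

  Ψ-supermartingale : ∀ t L G → 𝔼 {d = d} L (λ c → Ψ (suc t) (place L c) (update n T t L G)) ≤ Ψ t L G
  Ψ-supermartingale t L G = begin
    𝔼 L (λ c → ∑ (allFin n) (λ i → ∑ (allFin n) (Φ′ c i)))  ≡⟨ 𝔼-∑ L (allFin n) (λ i c → ∑ (allFin n) (Φ′ c i)) ⟩
    ∑ (allFin n) (λ i → 𝔼 L (λ c → ∑ (allFin n) (Φ′ c i)))  ≡⟨ ∑-cong (allFin n) (λ i _ → 𝔼-∑ L (allFin n) (λ j c → Φ′ c i j)) ⟩
    ∑ (allFin n) (λ i → ∑ (allFin n) (λ j → 𝔼 L (λ c → Φ′ c i j)))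
                                                            ≤⟨ ∑-mono (allFin n) (λ i → ∑-mono (allFin n) (Φ-supermartingale t L G i)) ⟩
    Ψ t L G                                                 ∎
    where
    open ≤-Reasoning
    Φ′ = λ c → Φ (suc t) (place L c) (update n T t L G)

  Ψ-at-horizon : ∀ t L G → T ℕ.≤ t → allPairsDone n (update n T t L G) ≡ false → fromℕ (suc T) ≤ Ψ t L G
  Ψ-at-horizon t L G T≤t not-all-done =
    ∑-≥-Any {xs = allFin n} (λ i → ∑-nonNeg (allFin n) (Φ-nonNeg t L G i))
      (Any.map (λ {i} → ∑-≥-Any (Φ-nonNeg t L G i) ∘ Any.map (Φ-at-horizon t L G i _ T≤t)) undone-pair)
    where
    flags = λ i → map (pairDone t L G i) (allFin n)
    undone-pair = Any.map Any.map⁻ (Any.concatMap⁻ flags (and≡false⇒Any (concatMap flags (allFin n)) not-all-done))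

  horizon-bound : ∀ t L G → T ℕ.≤ t →
                  (if allPairsDone n (update n T t L G) then 0ℚ else 1ℚ) * fromℕ (suc T) ≤ Ψ t L G
  horizon-bound t L G T≤t with allPairsDone n (update n T t L G) in all-done
  ... | true  = subst (_≤ Ψ t L G) (sym (*-zeroˡ (fromℕ (suc T)))) (Ψ-nonNeg t L G)
  ... | false = subst (_≤ Ψ t L G) (sym (*-identityˡ (fromℕ (suc T)))) (Ψ-at-horizon t L G T≤t all-done)

  failProb-bound : ∀ k t L G → T ℕ.≤ t ℕ.+ k → failProb n (suc d) T k t L G * fromℕ (suc T) ≤ Ψ t L G
  failProb-bound zero    t L G T≤t+0   = horizon-bound t L G (subst (T ℕ.≤_) (ℕ.+-identityʳ t) T≤t+0)
  failProb-bound (suc k) t L G T≤t+1+k = begin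
    𝔼 L rest * fromℕ (suc T)               ≡⟨ *-comm (𝔼 L rest) (fromℕ (suc T)) ⟩
    fromℕ (suc T) * 𝔼 L rest               ≡⟨ 𝔼-*ˡ L (fromℕ (suc T)) rest ⟨
    𝔼 L (λ c → fromℕ (suc T) * rest c)     ≤⟨ 𝔼-mono L (λ c → subst (_≤ Ψ (suc t) (place L c) G′) (*-comm (rest c) (fromℕ (suc T)))
                                                (failProb-bound k (suc t) (place L c) G′ (subst (T ℕ.≤_) (ℕ.+-suc t k) T≤t+1+k))) ⟩
    𝔼 L (λ c → Ψ (suc t) (place L c) G′)   ≤⟨ Ψ-supermartingale t L G ⟩
    Ψ t L G                                ∎
    where
    open ≤-Reasoning
    G′   = update n T t L G
    rest = λ c → failProb n (suc d) T k (suc t) (place L c) G′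

  Ψ-initial : Ψ 0 (λ _ → 0) (λ _ _ → false) ≤ fromℕ (n ℕ.* (n ℕ.* (N ℕ.* K)))
  Ψ-initial = begin
    Ψ 0 L₀ G₀                                                  ≤⟨ ∑-mono (allFin n) (λ i → ∑-mono (allFin n) (Φ₀≤NK i)) ⟩
    ∑ (allFin n) (λ _ → ∑ (allFin n) (λ _ → fromℕ (N ℕ.* K)))  ≡⟨ trans (∑-allFin-const n _) (cong (fromℕ n *_) (∑-allFin-const n _)) ⟩
    fromℕ n * (fromℕ n * fromℕ (N ℕ.* K))                     ≡⟨ trans (fromℕ-* n _) (cong (fromℕ n *_) (fromℕ-* n _)) ⟨
    fromℕ (n ℕ.* (n ℕ.* (N ℕ.* K)))                            ∎
    where
    open ≤-Reasoning
    L₀ : Loads n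
    L₀ _ = 0
    G₀ : Gaps n
    G₀ _ _ = false
    Φ₀≤NK : ∀ i j → Φ 0 L₀ G₀ i j ≤ fromℕ (N ℕ.* K)
    Φ₀≤NK i j = ≤-trans (Φ≤budget 0 L₀ G₀ i j (slack-nonNeg L₀ i j ℕ.z≤n))
      (≤-reflexive (trans (cong (_+ slack L₀ i j) fromℕ-0) (trans (+-identityˡ _) (slack≡fromℕ L₀ i j ℕ.z≤n))))

module FailureBound where
  open import Data.Nat as ℕ using (ℕ; suc; _^_; _*_; _+_; _≤_)
  import Data.Nat.Properties as ℕ
  open import Data.Nat.Solver using (module +-*-Solver)
  import Data.Rational as ℚ
  import Data.Rational.Properties as ℚ
  open import Relation.Binary.PropositionalEquality
  open import Defs using (unfairFail)
  open +-*-Solver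
  open FromNat

  polynomial-bound : ∀ n d → 1 ≤ n →
                     n * (n * (n ^ suc d * (n * n * (n * n)))) * n ^ (suc d + 1) ≤ suc (n ^ (3 * suc d + 12))
  polynomial-bound n@(suc _) d _ = ℕ.m≤n⇒m≤1+n (begin
    n * (n * (M * (n * n * (n * n)))) * n ^ (suc d + 1)  ≡⟨ cong (n * (n * (M * (n * n * (n * n)))) *_) (ℕ.^-distribˡ-+-* n (suc d) 1) ⟩
    n * (n * (M * (n * n * (n * n)))) * (M * (n * 1))    ≡⟨ collect n M ⟩
    M * M * n ^ 7                                        ≤⟨ ℕ.m≤m*n (M * M * n ^ 7) (M * n ^ 5) ⟩
    M * M * n ^ 7 * (M * n ^ 5)                          ≡⟨ regroup n M ⟩
    M ^ 3 * n ^ 12                                       ≡⟨ cong (_* n ^ 12) (trans (ℕ.^-*-assoc n (suc d) 3) (cong (n ^_) (ℕ.*-comm (suc d) 3))) ⟩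
    n ^ (3 * suc d) * n ^ 12                             ≡⟨ ℕ.^-distribˡ-+-* n (3 * suc d) 12 ⟨
    n ^ (3 * suc d + 12)                                 ∎)
    where
    open ℕ.≤-Reasoning
    M = n ^ suc d
    instance _ = ℕ.m*n≢0 M (n ^ 5) {{ℕ.m^n≢0 n (suc d)}} {{ℕ.m^n≢0 n 5}}
    collect : ∀ x y → x * (x * (y * (x * x * (x * x)))) * (y * (x * 1)) ≡ y * y * x ^ 7
    collect = solve 2 (λ x y → x :* (x :* (y :* (x :* x :* (x :* x)))) :* (y :* (x :* con 1)) := y :* y :* x :^ 7) refl
    regroup : ∀ x y → y * y * x ^ 7 * (y * x ^ 5) ≡ y ^ 3 * x ^ 12
    regroup = solve 2 (λ x y → y :* y :* x :^ 7 :* (y :* x :^ 5) := y :^ 3 :* x :^ 12) refl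

  ≤1-by-rescaling : ∀ {x : ℚ.ℚ} {B P S : ℕ} →
                    x ℚ.* fromℕ (suc S) ℚ.≤ fromℕ B → B * P ≤ suc S → x ℚ.* fromℕ P ℚ.≤ ℚ.1ℚ
  ≤1-by-rescaling {x} {B} {P} {S} x[S+1]≤B BP≤S+1 = ℚ.*-cancelʳ-≤-pos (fromℕ (suc S)) {{ℚ.positive 0<S+1}} (begin
    x ℚ.* fromℕ P ℚ.* fromℕ (suc S)    ≡⟨ ℚ.*-assoc x (fromℕ P) (fromℕ (suc S)) ⟩
    x ℚ.* (fromℕ P ℚ.* fromℕ (suc S))  ≡⟨ cong (x ℚ.*_) (ℚ.*-comm (fromℕ P) (fromℕ (suc S))) ⟩
    x ℚ.* (fromℕ (suc S) ℚ.* fromℕ P)  ≡⟨ ℚ.*-assoc x (fromℕ (suc S)) (fromℕ P) ⟨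
    x ℚ.* fromℕ (suc S) ℚ.* fromℕ P    ≤⟨ ℚ.*-monoʳ-≤-nonNeg (fromℕ P) {{ℚ.nonNegative (fromℕ-nonNeg P)}} x[S+1]≤B ⟩
    fromℕ B ℚ.* fromℕ P                ≡⟨ fromℕ-* B P ⟨
    fromℕ (B * P)                      ≤⟨ fromℕ-mono-≤ BP≤S+1 ⟩
    fromℕ (suc S)                      ≡⟨ ℚ.*-identityˡ (fromℕ (suc S)) ⟨
    ℚ.1ℚ ℚ.* fromℕ (suc S)             ∎)
    where
    open ℚ.≤-Reasoning
    0<S+1 : ℚ.0ℚ ℚ.< fromℕ (suc S)
    0<S+1 = ℚ.<-≤-trans (ℚ.positive⁻¹ ℚ.1ℚ) (subst (ℚ._≤ fromℕ (suc S)) fromℕ-1 (fromℕ-mono-≤ (ℕ.s≤s ℕ.z≤n)))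

  unfairFail-bound : ∀ n d → 1 ≤ n → ∀ m → n ^ (3 * suc d + 12) ≤ m →
                     unfairFail m n (suc d) (n ^ (3 * suc d + 12)) ℚ.* fromℕ (n ^ (suc d + 1)) ℚ.≤ ℚ.1ℚ
  unfairFail-bound n d 1≤n m T≤m = ≤1-by-rescaling {x = unfairFail m n (suc d) (n ^ (3 * suc d + 12))}
    (ℚ.≤-trans (failProb-bound m 0 _ _ T≤m) Ψ-initial) (polynomial-bound n d 1≤n)
    where open PairPotential n d (n ^ (3 * suc d + 12))

open import Defs
open import Data.Nat using (ℕ; _≤_; _^_; _+_; _*_)
open import Data.Integer using (+_)
open import Data.Rational using (ℚ; _/_) renaming (_*_ to _*ℚ_; _≤_ to _≤ℚ_)
open import Data.Product using (∃; ∃-syntax)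
open import Data.Nat using (suc)
open import Data.Product using (_,_)
open import Relation.Binary.PropositionalEquality using (subst)

lemma1 : ∀ (d : ℕ) → 1 ≤ d →
    ∃[ C ] ∃[ N ] ∀ (n : ℕ) → 1 ≤ n → N ≤ n → ∀ (m : ℕ) → n ^ (3 * d + 12) ≤ m →
      unfairFail m n d (n ^ (3 * d + 12)) *ℚ ((+ (n ^ (d + 1))) / 1) ≤ℚ (+ C) / 1
lemma1 (suc d) _ = 1 , 1 , λ n 1≤n _ m T≤m →
  subst (λ p → unfairFail m n (suc d) (n ^ (3 * suc d + 12)) *ℚ p ≤ℚ (+ 1) / 1)
        (FromNat.fromℕ≡+/1 (n ^ (suc d + 1)))
        (FailureBound.unfairFail-bound n d 1≤n m T≤m)
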